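{- In the $F_4$ Black Hole Zeckendorf game, for every $a\in\mathbb{Z}_{\ge0}$ with $a\neq 2$, the position $(a,0,0)$ is a $P$ position.
   Context: The $F_4$ Black Hole Zeckendorf game: a position is a triple $(a,b,c)$ of nonnegative integers, the numbers of pieces in the columns of weights $F_1=1$, $F_2=2$, $F_3=3$. Two players alternate moves; the available moves are: (M) if $a\ge2$, go to $(a-2,b+1,c)$; (A$_1$) if $a,b\ge1$, go to $(a-1,b-1,c+1)$; (A$_2$) if $b,c\ge1$, go to $(a,b-1,c-1)$; (S$_2$) if $b\ge2$, go to $(a+1,b-2,c+1)$; (S$_3$) if $c\ge2$, go to $(a+1,b,c-2)$ (pieces landing in column $F_4=5$, the "black hole", are removed). The player making the last move wins. A position is a $P$ position if the player to move from it loses under optimal play, and an $N$ position if the player to move can force a win; positions with no move are $P$ positions. -}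

module Defs where

open import Data.Nat using (ℕ; zero; suc; _+_)
open import Data.Product using (_×_; _,_; Σ; ∃)

-- A position (a , b , c): numbers of pieces in columns F1=1, F2=2, F3=3.
Position : Set
Position = ℕ × ℕ × ℕ

data Move : Position → Position → Set where
  M  : ∀ {a b c} → Move (suc (suc a) , b , c) (a , suc b , c)
  A₁ : ∀ {a b c} → Move (suc a , suc b , c) (a , b , suc c)
  A₂ : ∀ {a b c} → Move (a , suc b , suc c) (a , b , c)
  S₂ : ∀ {a b c} → Move (a , suc (suc b) , c) (suc a , b , suc c)
  S₃ : ∀ {a b c} → Move (a , b , suc (suc c)) (suc a , b , c)

-- P and N positions (normal play: last mover wins), defined by the usual
-- mutual recursion: a position is N if some move leads to a P position,
-- and P if every move leads to an N position (so terminal positions are P).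
data IsP : Position → Set
data IsN : Position → Set

data IsP where
  allN : ∀ {p} → (∀ {q} → Move p q → IsN q) → IsP p

data IsN where
  someP : ∀ {p q} → Move p q → IsP q → IsN p

{-# OPTIONS --safe #-}
module Submission where

open import Defs
open import Data.Nat using (ℕ; suc; _+_)
open import Data.Product using (_,_)
open import Data.Empty using (⊥-elim)
open import Relation.Binary.PropositionalEquality using (_≡_; refl)
open import Relation.Nullary using (¬_)

-- From (3+a,0,0) the only move is M, to (1+a,1,0), which A₁ answers with
-- (a,0,1). From there the only move is M, to (a-2,1,1), which A₂ answers
-- with (a-2,0,0), closing the induction, unless a-2 = 2: then A₁ leads to
-- (1,0,2), whose only move S₃ hands the opponent the N position (2,0,0).

isN-2,0,0 : IsN (2 , 0 , 0)
isN-2,0,0 = someP M (allN λ ())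

isP-1,0,2 : IsP (1 , 0 , 2)
isP-1,0,2 = allN λ { S₃ → isN-2,0,0 }

mutual
  isP-3+a,0,0 : ∀ a → IsP (3 + a , 0 , 0)
  isP-3+a,0,0 a = allN λ { M → isN-1+a,1,0 a }

  isN-1+a,1,0 : ∀ a → IsN (suc a , 1 , 0)
  isN-1+a,1,0 a = someP A₁ (isP-a,0,1 a)

  isP-a,0,1 : ∀ a → IsP (a , 0 , 1)
  isP-a,0,1 0             = allN λ ()
  isP-a,0,1 1             = allN λ ()
  isP-a,0,1 (suc (suc a)) = allN λ { M → isN-a,1,1 a }

  isN-a,1,1 : ∀ a → IsN (a , 1 , 1)
  isN-a,1,1 0                   = someP A₂ (allN λ ())
  isN-a,1,1 1                   = someP A₂ (allN λ ())
  isN-a,1,1 2                   = someP A₁ isP-1,0,2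
  isN-a,1,1 (suc (suc (suc a))) = someP A₂ (isP-3+a,0,0 a)

theorem5p1 : (a : ℕ) → ¬ (a ≡ 2) → IsP (a , 0 , 0)
theorem5p1 0                   _   = allN λ ()
theorem5p1 1                   _   = allN λ ()
theorem5p1 2                   a≢2 = ⊥-elim (a≢2 refl)
theorem5p1 (suc (suc (suc a))) _   = isP-3+a,0,0 a
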